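{- Let $n = p_1^{n_1} p_2^{n_2} \cdots p_k^{n_k}$ where $p_1, \dots, p_k$ are distinct primes and $n_i \in \mathbb{N}$ for every $i$. Then the number of maximal cliques in $\mathrm{Endo}(\mathbb{Z}_n)$ is $$\frac{(n_1 + n_2 + \cdots + n_k)!}{n_1!\, n_2! \cdots n_k!}.$$
   Context: $\mathbb{Z}_n$ is the cyclic group of integers modulo $n$ under addition. For a finite group $G$, $\mathrm{Endo}(G)$ is the simple undirected graph with vertex set $G$ in which distinct $a,b$ are adjacent iff there is a group endomorphism of $G$ mapping $a$ to $b$ or mapping $b$ to $a$. A maximal clique is a complete subgraph not contained in a larger complete subgraph. -}

module Defs where

open import Data.Nat using (ℕ; zero; suc; _+_; _*_; _^_; NonZero; _!)
open import Data.Nat.Properties using (m*n≢0)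
open import Data.Nat.DivMod using (_%_; _/_; m%n<n)
open import Data.Nat.Properties using (_!≢0)
open import Data.Fin using (Fin; toℕ; fromℕ<)
import Data.Fin as F
open import Data.Fin.Subset using (Subset; _∈_; _⊆_)
open import Data.List using (List; length)
open import Data.List.Membership.Propositional renaming (_∈_ to _∈ₗ_)
open import Data.List.Relation.Unary.Unique.Propositional using (Unique)
open import Data.Product using (Σ; _×_; ∃)
open import Data.Sum using (_⊎_)
open import Function.Bundles using (_⇔_)
open import Relation.Binary.PropositionalEquality using (_≡_; _≢_)

_+ₙ_ : ∀ {n} → Fin n → Fin n → Fin n
_+ₙ_ {suc m} a b = fromℕ< (m%n<n (toℕ a + toℕ b) (suc m))

IsEndo : ∀ {n} → (Fin n → Fin n) → Set
IsEndo {n} f = ∀ (a b : Fin n) → f (a +ₙ b) ≡ f a +ₙ f b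

EndoAdj : ∀ {n} → Fin n → Fin n → Set
EndoAdj {n} a b = a ≢ b ×
  ((Σ (Fin n → Fin n) λ f → IsEndo f × f a ≡ b) ⊎
   (Σ (Fin n → Fin n) λ f → IsEndo f × f b ≡ a))

IsClique : ∀ {n} → Subset n → Set
IsClique {n} S = ∀ (a b : Fin n) → a ∈ S → b ∈ S → a ≢ b → EndoAdj a b

IsMaximalClique : ∀ {n} → Subset n → Set
IsMaximalClique {n} S = IsClique S × (∀ (T : Subset n) → IsClique T → S ⊆ T → T ⊆ S)

NumMaximalCliques : ℕ → ℕ → Set
NumMaximalCliques n N = Σ (List (Subset n)) λ L →
  Unique L × (∀ S → (S ∈ₗ L) ⇔ IsMaximalClique S) × length L ≡ N

sumF : ∀ {k} → (Fin k → ℕ) → ℕ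
sumF {zero} e = 0
sumF {suc k} e = e F.zero + sumF (λ i → e (F.suc i))

prodF : ∀ {k} → (Fin k → ℕ) → ℕ
prodF {zero} e = 1
prodF {suc k} e = e F.zero * prodF (λ i → e (F.suc i))

prodFact≢0 : ∀ {k} (e : Fin k → ℕ) → NonZero (prodF (λ i → e i !))
prodFact≢0 {zero} e = _
prodFact≢0 {suc k} e =
  m*n≢0 (e F.zero !) (prodF (λ i → e (F.suc i) !))
    {{e F.zero !≢0}} {{prodFact≢0 (λ i → e (F.suc i))}}

multinomial : ∀ {k} → (Fin k → ℕ) → ℕ
multinomial e = ((sumF e) ! / prodF (λ i → e i !)) {{prodFact≢0 e}}

{-# OPTIONS --safe #-}
-- Every endomorphism of ℤ_n is multiplication by a constant, and by Bézout a can be sent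
-- to b by one exactly when gcd(a,n) divides gcd(b,n). So a and b are adjacent iff their
-- gcds with n are comparable under divisibility, and the maximal cliques are the sets
-- {a : gcd(a,n) ∈ C} for the maximal chains C = (1 = d₀ ∣ d₁ ∣ ⋯ ∣ d_N = n) of divisors
-- of n. Each quotient d_{j+1}/d_j of a maximal chain is a prime, p_i occurring n_i times,
-- so maximal chains are the words in the letters p_i with these multiplicities, which
-- the multinomial coefficient counts.
module Submission where

open import Defs
open import Data.Nat
  using (ℕ; zero; suc; _+_; _*_; _^_; _!; pred; _<_; z<s; >-nonZero; ≢-nonZero; _≟_; nonTrivial⇒n>1)
open import Data.Nat.Properties
open import Algebra.Properties.CommutativeSemigroup *-commutativeSemigroup
  using () renaming (x∙yz≈y∙xz to x*[y*z]≡y*[x*z]; xy∙z≈xz∙y to x*y*z≡x*z*y)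
open import Data.Nat.DivMod
open import Data.Nat.Divisibility
open import Data.Nat.GCD using (gcd; gcd[m,n]∣m; gcd[m,n]∣n; gcd-greatest; gcd-GCD; module Bézout)
open import Data.Nat.Coprimality using (Coprime; gcd≡1⇒coprime; coprime-divisor)
open import Data.Nat.Primality using (Prime; prime⇒irreducible; prime⇒nonZero; prime⇒nonTrivial)
open import Data.Nat.Solver using (module +-*-Solver)
open import Data.Fin using (Fin; zero; suc; toℕ)
import Data.Fin.Properties as Fin
open import Data.Fin.Subset using (Subset) renaming (_∈_ to _∈ₛ_; _⊆_ to _⊆ₛ_)
open import Data.Fin.Subset.Properties using (⊆-antisym) renaming (_∈?_ to _∈ₛ?_)
open import Data.Vec using (tabulate)
open import Data.Vec.Properties using (lookup∘tabulate; []=⇒lookup; lookup⇒[]=)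
open import Data.Vec.Functional using (updateAt)
open import Data.List using (List; []; _∷_; [_]; _++_; map; length; filter; allFin)
open import Data.List.Properties using (length-++; length-map; ∷-injectiveˡ; ∷-injectiveʳ)
open import Data.List.Membership.Propositional using (_∈_)
open import Data.List.Membership.Propositional.Properties
  using (∈-map⁺; ∈-map⁻; ∈-++⁺ˡ; ∈-++⁺ʳ; ∈-++⁻; map∷⁻; ∈-filter⁺; ∈-filter⁻; ∈-allFin)
open import Data.List.Membership.DecPropositional _≟_ using (_∈?_)
open import Data.List.Relation.Binary.Subset.Propositional using (_⊆_)
open import Data.List.Relation.Unary.Any using (here; there)
open import Data.List.Relation.Unary.All using ([])
import Data.List.Relation.Unary.All as All
import Data.List.Relation.Unary.All.Properties as All
open import Data.List.Relation.Unary.AllPairs using ([]; _∷_)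
open import Data.List.Relation.Unary.Unique.Propositional using (Unique)
import Data.List.Relation.Unary.Unique.Propositional.Properties as Unique
open import Data.List.Extrema.Nat using (min; min≤xs; argmin-all)
open import Data.Product using (Σ; _×_; _,_; proj₁; proj₂; ∃; ∃-syntax)
import Data.Product as Product
open import Data.Sum using (_⊎_; inj₁; inj₂; [_,_]′)
import Data.Sum as Sum
open import Data.Empty using (⊥-elim)
open import Function using (_∘_; id)
open import Function.Bundles using (_⇔_; mk⇔; Equivalence)
open import Function.Definitions using (Injective)
open import Level using (0ℓ)
open import Relation.Nullary using (¬_; does; proof; yes; no; ¬?)
open import Relation.Nullary.Decidable using (dec-true)
open import Relation.Nullary.Reflects using (Reflects; invert)
open import Relation.Unary using (Pred; Decidable)
open import Relation.Binary.PropositionalEquality hiding ([_])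

open Equivalence using (to; from)

private variable
  A : Set
  k N B t : ℕ

concatF : (Fin k → List A) → List A
concatF {k = zero}  g = []
concatF {k = suc k} g = g zero ++ concatF (g ∘ suc)

length-concatF : (g : Fin k → List A) → length (concatF g) ≡ sumF (length ∘ g)
length-concatF {k = zero}  g = refl
length-concatF {k = suc k} g =
  trans (length-++ (g zero)) (cong (length (g zero) +_) (length-concatF (g ∘ suc)))

∈-concatF⁺ : (g : Fin k → List A) (i : Fin k) {x : A} → x ∈ g i → x ∈ concatF g
∈-concatF⁺ g zero    x∈ = ∈-++⁺ˡ x∈
∈-concatF⁺ g (suc i) x∈ = ∈-++⁺ʳ (g zero) (∈-concatF⁺ (g ∘ suc) i x∈)

∈-concatF⁻ : (g : Fin k → List A) {x : A} → x ∈ concatF g → ∃ λ i → x ∈ g i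
∈-concatF⁻ {k = suc k} g x∈ with ∈-++⁻ (g zero) x∈
... | inj₁ x∈g₀ = zero , x∈g₀
... | inj₂ x∈gₛ with ∈-concatF⁻ (g ∘ suc) x∈gₛ
...   | i , x∈gᵢ = suc i , x∈gᵢ

concatF-unique : (g : Fin k → List A) → (∀ i → Unique (g i)) →
  (∀ {i j x} → x ∈ g i → x ∈ g j → i ≡ j) → Unique (concatF g)
concatF-unique {k = zero}  g _ _ = []
concatF-unique {k = suc k} g unique disjoint =
  Unique.++⁺ (unique zero)
    (concatF-unique (g ∘ suc) (unique ∘ suc) (λ x∈ x∈′ → Fin.suc-injective (disjoint x∈ x∈′)))
    λ (x∈g₀ , x∈gₛ) → let _ , x∈gᵢ = ∈-concatF⁻ (g ∘ suc) x∈gₛ in Fin.0≢1+n (disjoint x∈g₀ x∈gᵢ)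

sumF-updateAt-pred : (e : Fin k → ℕ) (i : Fin k) {u : ℕ} → e i ≡ suc u → sumF e ≡ suc N →
  sumF (updateAt e i pred) ≡ N
sumF-updateAt-pred e i eᵢ≡ Σe≡ = suc-injective (trans (sym (sumF-suc e i eᵢ≡)) Σe≡)
  where
  sumF-suc : ∀ {k} (e : Fin k → ℕ) i {u} → e i ≡ suc u → sumF e ≡ suc (sumF (updateAt e i pred))
  sumF-suc e zero    eᵢ≡ rewrite eᵢ≡ = refl
  sumF-suc e (suc i) eᵢ≡ = trans (cong (e zero +_) (sumF-suc (e ∘ suc) i eᵢ≡)) (+-suc (e zero) _)

prodF-updateAt-pred : (φ : Fin k → ℕ → ℕ) (e : Fin k → ℕ) (i : Fin k) (c : ℕ) {u : ℕ} →
  e i ≡ suc u → φ i (suc u) ≡ c * φ i u →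
  prodF (λ j → φ j (e j)) ≡ c * prodF (λ j → φ j (updateAt e i pred j))
prodF-updateAt-pred φ e zero    c {u} eᵢ≡ φ≡ rewrite eᵢ≡ | φ≡ = *-assoc c (φ zero u) _
prodF-updateAt-pred φ e (suc i) c eᵢ≡ φ≡ = begin
  φ zero (e zero) * prodF (λ j → φ (suc j) (e (suc j)))
    ≡⟨ cong (φ zero (e zero) *_) (prodF-updateAt-pred (φ ∘ suc) (e ∘ suc) i c eᵢ≡ φ≡) ⟩
  φ zero (e zero) * (c * R)    ≡⟨ x*[y*z]≡y*[x*z] (φ zero (e zero)) c R ⟩
  c * (φ zero (e zero) * R)    ∎
  where
  open ≡-Reasoning
  R : ℕ
  R = prodF (λ j → φ (suc j) (updateAt (e ∘ suc) i pred j))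

sumF≡0⇒prodF≡1 : (φ : Fin k → ℕ → ℕ) (e : Fin k → ℕ) → (∀ j → φ j 0 ≡ 1) →
  sumF e ≡ 0 → prodF (λ j → φ j (e j)) ≡ 1
sumF≡0⇒prodF≡1 {k = zero}  φ e φ0≡1 _ = refl
sumF≡0⇒prodF≡1 {k = suc k} φ e φ0≡1 Σe≡0
  rewrite m+n≡0⇒m≡0 (e zero) Σe≡0 | φ0≡1 zero
  = trans (+-identityʳ _) (sumF≡0⇒prodF≡1 (φ ∘ suc) (e ∘ suc) (φ0≡1 ∘ suc) (m+n≡0⇒n≡0 (e zero) Σe≡0))

sumF≡suc⇒positive : (e : Fin k → ℕ) → sumF e ≡ suc N → ∃[ i ] ∃[ u ] e i ≡ suc u
sumF≡suc⇒positive {k = suc k} e Σe≡ with e zero in e₀≡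
... | suc u = zero , u , e₀≡
... | zero  = let i , u , eᵢ≡ = sumF≡suc⇒positive (e ∘ suc) Σe≡ in suc i , u , eᵢ≡

sumF-*-cong : (a b : Fin k → ℕ) {c d : ℕ} → (∀ i → a i * c ≡ b i * d) → sumF a * c ≡ sumF b * d
sumF-*-cong {k = zero}  a b eq = refl
sumF-*-cong {k = suc k} a b {c} {d} eq = begin
  (a zero + sumF (a ∘ suc)) * c      ≡⟨ *-distribʳ-+ c (a zero) _ ⟩
  a zero * c + sumF (a ∘ suc) * c    ≡⟨ cong₂ _+_ (eq zero) (sumF-*-cong (a ∘ suc) (b ∘ suc) (eq ∘ suc)) ⟩
  b zero * d + sumF (b ∘ suc) * d    ≡⟨ *-distribʳ-+ d (b zero) _ ⟨
  (b zero + sumF (b ∘ suc)) * d      ∎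
  where open ≡-Reasoning

whenPositive : ℕ → List A → List A
whenPositive zero    _  = []
whenPositive (suc _) xs = xs

-- When sumF e ≡ N, the words of length N in which each letter i occurs exactly e i times.
words : ℕ → (Fin k → ℕ) → List (List (Fin k))
words zero    e = [ [] ]
words (suc N) e = concatF λ i → map (i ∷_) (whenPositive (e i) (words N (updateAt e i pred)))

∈-words-suc⁺ : (e : Fin k → ℕ) (i : Fin k) {u : ℕ} {w : List (Fin k)} → e i ≡ suc u →
  w ∈ words N (updateAt e i pred) → i ∷ w ∈ words (suc N) e
∈-words-suc⁺ {N = N} e i {w = w} eᵢ≡ w∈ = ∈-concatF⁺ _ i (∈-map⁺ (i ∷_) w∈′)
  where
  w∈′ : w ∈ whenPositive (e i) (words N (updateAt e i pred))
  w∈′ rewrite eᵢ≡ = w∈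

∈-words-suc⁻ : (e : Fin k → ℕ) {w : List (Fin k)} → w ∈ words (suc N) e →
  ∃[ i ] ∃[ u ] ∃[ w′ ] e i ≡ suc u × w ≡ i ∷ w′ × w′ ∈ words N (updateAt e i pred)
∈-words-suc⁻ e w∈ with ∈-concatF⁻ _ w∈
... | i , w∈ᵢ with e i in eᵢ≡ | map∷⁻ {y = i} w∈ᵢ
...   | suc u | w′ , w′∈ , w≡ = i , u , w′ , eᵢ≡ , w≡ , w′∈

words-unique : ∀ N (e : Fin k → ℕ) → Unique (words N e)
words-unique zero    e = [] ∷ []
words-unique (suc N) e =
  concatF-unique _ (λ i → Unique.map⁺ ∷-injectiveʳ (positive-unique (e i)))
    λ x∈ x∈′ → head-unique (map∷⁻ x∈) (map∷⁻ x∈′)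
  where
  positive-unique : ∀ m {i} → Unique (whenPositive m (words N (updateAt e i pred)))
  positive-unique zero    = []
  positive-unique (suc _) = words-unique N _
  head-unique : ∀ {i j x} {xs ys : List (List (Fin _))} →
    ∃[ y ] y ∈ xs × x ≡ i ∷ y → ∃[ y ] y ∈ ys × x ≡ j ∷ y → i ≡ j
  head-unique (_ , _ , refl) (_ , _ , x≡) = ∷-injectiveˡ x≡

length-words : ∀ N (e : Fin k → ℕ) → sumF e ≡ N → length (words N e) * prodF (λ i → e i !) ≡ N !
length-words zero    e Σe≡0 = cong (1 *_) (sumF≡0⇒prodF≡1 (λ _ x → x !) e (λ _ → refl) Σe≡0)
length-words (suc N) e Σe≡ = begin
  length (words (suc N) e) * Π   ≡⟨ cong (_* Π) (length-concatF blocks) ⟩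
  sumF (length ∘ blocks) * Π      ≡⟨ sumF-*-cong (length ∘ blocks) e block ⟩
  sumF e * N !                    ≡⟨ cong (_* N !) Σe≡ ⟩
  suc N * N !                     ∎
  where
  open ≡-Reasoning
  Π : ℕ
  Π = prodF (λ i → e i !)
  blocks : Fin _ → List (List (Fin _))
  blocks i = map (i ∷_) (whenPositive (e i) (words N (updateAt e i pred)))
  block : ∀ i → length (blocks i) * Π ≡ e i * N !
  block i with e i in eᵢ≡
  ... | zero  = refl
  ... | suc u = begin
    length (map (i ∷_) W) * Π      ≡⟨ cong (_* Π) (length-map (i ∷_) W) ⟩
    length W * Π
      ≡⟨ cong (length W *_) (prodF-updateAt-pred (λ _ x → x !) e i (suc u) eᵢ≡ refl) ⟩
    length W * (suc u * Π′)        ≡⟨ x*[y*z]≡y*[x*z] (length W) (suc u) Π′ ⟩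
    suc u * (length W * Π′)        ≡⟨ cong (suc u *_) (length-words N _ (sumF-updateAt-pred e i eᵢ≡ Σe≡)) ⟩
    suc u * N !                    ∎
    where
    W : List (List (Fin _))
    W = words N (updateAt e i pred)
    Π′ : ℕ
    Π′ = prodF (λ j → updateAt e i pred j !)

multinomial≡length-words : (e : Fin k → ℕ) → multinomial e ≡ length (words (sumF e) e)
multinomial≡length-words e =
  trans (cong (λ x → (x / prodF (λ i → e i !)) {{prodFact≢0 e}}) (sym (length-words (sumF e) e refl)))
        (m*n/n≡m _ _ {{prodFact≢0 e}})

Comparable : ℕ → ℕ → Set
Comparable x y = x ∣ y ⊎ y ∣ x

module ℤ/suc (m : ℕ) where

  n : ℕ
  n = suc m

  toℕ-mod : ∀ x → toℕ (x mod n) ≡ x % n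
  toℕ-mod x = Fin.toℕ-fromℕ< (m%n<n x n)

  mod-cong : ∀ x y → x % n ≡ y % n → x mod n ≡ y mod n
  mod-cong x y eq = Fin.toℕ-injective (trans (toℕ-mod x) (trans eq (sym (toℕ-mod y))))

  toℕ-mod-inverse : (a : Fin n) → toℕ a mod n ≡ a
  toℕ-mod-inverse a = Fin.toℕ-injective (trans (toℕ-mod (toℕ a)) (m<n⇒m%n≡m (Fin.toℕ<n a)))

  mod-+ : ∀ x y → (x mod n) +ₙ (y mod n) ≡ (x + y) mod n
  mod-+ x y = mod-cong (toℕ (x mod n) + toℕ (y mod n)) (x + y) (begin
    (toℕ (x mod n) + toℕ (y mod n)) % n  ≡⟨ cong₂ (λ u v → (u + v) % n) (toℕ-mod x) (toℕ-mod y) ⟩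
    (x % n + y % n) % n                  ≡⟨ %-distribˡ-+ x y n ⟨
    (x + y) % n                          ∎)
    where open ≡-Reasoning

  [x%n*c]%n≡[x*c]%n : ∀ x c → (x % n * c) % n ≡ (x * c) % n
  [x%n*c]%n≡[x*c]%n x c = begin
    (x % n * c) % n              ≡⟨ %-distribˡ-* (x % n) c n ⟩
    (x % n % n * (c % n)) % n    ≡⟨ cong (λ z → (z * (c % n)) % n) (m%n%n≡m%n x n) ⟩
    (x % n * (c % n)) % n        ≡⟨ %-distribˡ-* x c n ⟨
    (x * c) % n                  ∎
    where open ≡-Reasoning

  scale : ℕ → Fin n → Fin n
  scale c a = (toℕ a * c) mod n

  scale-isEndo : ∀ c → IsEndo (scale c)
  scale-isEndo c a b = mod-cong (toℕ (a +ₙ b) * c) (toℕ (scale c a) + toℕ (scale c b)) (begin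
    (toℕ (a +ₙ b) * c) % n                   ≡⟨ cong (λ z → (z * c) % n) (toℕ-mod (toℕ a + toℕ b)) ⟩
    ((toℕ a + toℕ b) % n * c) % n            ≡⟨ [x%n*c]%n≡[x*c]%n (toℕ a + toℕ b) c ⟩
    ((toℕ a + toℕ b) * c) % n                ≡⟨ cong (_% n) (*-distribʳ-+ c (toℕ a) (toℕ b)) ⟩
    (toℕ a * c + toℕ b * c) % n              ≡⟨ %-distribˡ-+ (toℕ a * c) (toℕ b * c) n ⟩
    ((toℕ a * c) % n + (toℕ b * c) % n) % n
      ≡⟨ cong₂ (λ u v → (u + v) % n) (toℕ-mod (toℕ a * c)) (toℕ-mod (toℕ b * c)) ⟨
    (toℕ (scale c a) + toℕ (scale c b)) % n  ∎)
    where open ≡-Reasoning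

  -- Evaluating at suc x, and reaching a as a + n, avoids needing f 0 ≡ 0,
  -- which would require cancellation in ℤ_n.
  endo≗scale : {f : Fin n → Fin n} → IsEndo f → ∀ a → f a ≡ scale (toℕ (f (1 mod n))) a
  endo≗scale {f} f-endo a = begin
    f a                          ≡⟨ cong f a≡ ⟨
    f (suc (toℕ a + m) mod n)    ≡⟨ f-suc (toℕ a + m) ⟩
    (suc (toℕ a + m) * c) mod n  ≡⟨ mod-cong (suc (toℕ a + m) * c) (toℕ a * c) (begin
      (suc (toℕ a + m) * c) % n    ≡⟨ cong (λ z → (z * c) % n) (+-suc (toℕ a) m) ⟨
      ((toℕ a + n) * c) % n        ≡⟨ cong (_% n) (*-distribʳ-+ c (toℕ a) n) ⟩
      (toℕ a * c + n * c) % n      ≡⟨ cong (λ z → (toℕ a * c + z) % n) (*-comm n c) ⟩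
      (toℕ a * c + c * n) % n      ≡⟨ [m+kn]%n≡m%n (toℕ a * c) c n ⟩
      (toℕ a * c) % n              ∎) ⟩
    scale c a                    ∎
    where
    open ≡-Reasoning
    c : ℕ
    c = toℕ (f (1 mod n))
    f-suc : ∀ x → f (suc x mod n) ≡ (suc x * c) mod n
    f-suc zero    = trans (sym (toℕ-mod-inverse _)) (cong (_mod n) (sym (+-identityʳ c)))
    f-suc (suc x) = begin
      f (suc (suc x) mod n)             ≡⟨ cong f (trans (cong (_mod n) (+-comm 1 (suc x))) (sym (mod-+ (suc x) 1))) ⟩
      f ((suc x mod n) +ₙ (1 mod n))    ≡⟨ f-endo (suc x mod n) (1 mod n) ⟩
      f (suc x mod n) +ₙ f (1 mod n)    ≡⟨ cong₂ _+ₙ_ (f-suc x) (sym (toℕ-mod-inverse _)) ⟩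
      ((suc x * c) mod n) +ₙ (c mod n)  ≡⟨ mod-+ (suc x * c) c ⟩
      (suc x * c + c) mod n             ≡⟨ cong (_mod n) (+-comm (suc x * c) c) ⟩
      (suc (suc x) * c) mod n           ∎
    a≡ : suc (toℕ a + m) mod n ≡ a
    a≡ = trans (mod-cong (suc (toℕ a + m)) (toℕ a)
                 (trans (cong (_% n) (sym (+-suc (toℕ a) m))) ([m+n]%n≡m%n (toℕ a) n)))
               (toℕ-mod-inverse a)

  gcdₙ : Fin n → ℕ
  gcdₙ a = gcd (toℕ a) n

  gcdₙ-∣-scale : ∀ c a → gcdₙ a ∣ gcdₙ (scale c a)
  gcdₙ-∣-scale c a = gcd-greatest
    (subst (gcdₙ a ∣_) (sym (toℕ-mod (toℕ a * c)))
      (%-presˡ-∣ (∣m⇒∣m*n c (gcd[m,n]∣m (toℕ a) n)) (gcd[m,n]∣n (toℕ a) n)))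
    (gcd[m,n]∣n (toℕ a) n)

  bézout-mod : ∀ x → ∃[ c ] (x * c) % n ≡ gcd x n % n
  bézout-mod x with gcd x n | Bézout.identity (gcd-GCD x n)
  ... | d | Bézout.+- c y eq = c , (begin
    (x * c) % n      ≡⟨ cong (_% n) (*-comm x c) ⟩
    (c * x) % n      ≡⟨ cong (_% n) eq ⟨
    (d + y * n) % n  ≡⟨ [m+kn]%n≡m%n d y n ⟩
    d % n            ∎)
    where open ≡-Reasoning
  -- Here c * x ≡ - d modulo n, and multiplying by m ≡ - 1 flips the sign.
  ... | d | Bézout.-+ c y eq = c * m , (begin
    (x * (c * m)) % n          ≡⟨ [m+kn]%n≡m%n (x * (c * m)) d n ⟨
    (x * (c * m) + d * n) % n  ≡⟨ cong (_% n) (rearrange x c m d) ⟩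
    (d + (d + c * x) * m) % n  ≡⟨ cong (λ z → (d + z * m) % n) eq ⟩
    (d + y * n * m) % n        ≡⟨ cong (λ z → (d + z) % n) (x*y*z≡x*z*y y n m) ⟩
    (d + y * m * n) % n        ≡⟨ [m+kn]%n≡m%n d (y * m) n ⟩
    d % n                      ∎)
    where
    open ≡-Reasoning
    open +-*-Solver
    rearrange : ∀ x c m d → x * (c * m) + d * suc m ≡ d + (d + c * x) * m
    rearrange = solve 4 (λ x c m d → x :* (c :* m) :+ d :* (con 1 :+ m) := d :+ (d :+ c :* x) :* m) refl

  gcdₙ-∣⇒scale : ∀ a b → gcdₙ a ∣ gcdₙ b → ∃[ c ] scale c a ≡ b
  gcdₙ-∣⇒scale a b gcdₐ∣gcd_b with ∣-trans gcdₐ∣gcd_b (gcd[m,n]∣m (toℕ b) n) | bézout-mod (toℕ a)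
  ... | divides t b≡t*d | c , ac≡d = c * t , Fin.toℕ-injective (begin
    toℕ ((a′ * (c * t)) mod n)  ≡⟨ toℕ-mod (a′ * (c * t)) ⟩
    (a′ * (c * t)) % n          ≡⟨ cong (_% n) (*-assoc a′ c t) ⟨
    (a′ * c * t) % n            ≡⟨ [x%n*c]%n≡[x*c]%n (a′ * c) t ⟨
    ((a′ * c) % n * t) % n      ≡⟨ cong (λ z → (z * t) % n) ac≡d ⟩
    (d % n * t) % n             ≡⟨ [x%n*c]%n≡[x*c]%n d t ⟩
    (d * t) % n                 ≡⟨ cong (_% n) (trans (*-comm d t) (sym b≡t*d)) ⟩
    toℕ b % n                   ≡⟨ m<n⇒m%n≡m (Fin.toℕ<n b) ⟩
    toℕ b                       ∎)
    where
    open ≡-Reasoning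
    a′ : ℕ
    a′ = toℕ a
    d : ℕ
    d = gcdₙ a

  endoImage⇔gcdₙ-∣ : ∀ a b → (Σ (Fin n → Fin n) λ f → IsEndo f × f a ≡ b) ⇔ gcdₙ a ∣ gcdₙ b
  endoImage⇔gcdₙ-∣ a b = mk⇔
    (λ (f , f-endo , fa≡b) → subst (λ z → gcdₙ a ∣ gcdₙ z) (trans (sym (endo≗scale {f} f-endo a)) fa≡b)
                                (gcdₙ-∣-scale _ a))
    (λ gcdₐ∣gcd_b → let c , ca≡b = gcdₙ-∣⇒scale a b gcdₐ∣gcd_b in scale c , scale-isEndo c , ca≡b)

  endoAdj⇔ : ∀ {a b} → EndoAdj a b ⇔ (a ≢ b × Comparable (gcdₙ a) (gcdₙ b))
  endoAdj⇔ {a} {b} = mk⇔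
    (Product.map₂ (Sum.map (to (endoImage⇔gcdₙ-∣ a b)) (to (endoImage⇔gcdₙ-∣ b a))))
    (Product.map₂ (Sum.map (from (endoImage⇔gcdₙ-∣ a b)) (from (endoImage⇔gcdₙ-∣ b a))))

  gcdₙ-mod : ∀ {d} → d ∣ n → gcdₙ (d mod n) ≡ d
  gcdₙ-mod {d} d∣n = ∣-antisym
    (∣n∣m%n⇒∣m (gcd[m,n]∣n (toℕ (d mod n)) n)
      (subst (gcdₙ (d mod n) ∣_) (toℕ-mod d) (gcd[m,n]∣m (toℕ (d mod n)) n)))
    (gcd-greatest (subst (d ∣_) (sym (toℕ-mod d)) (%-presˡ-∣ ∣-refl d∣n)) d∣n)

IsChain : List ℕ → Set
IsChain Q = ∀ {x y} → x ∈ Q → y ∈ Q → Comparable x y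

prodF-pos : (g : Fin k → ℕ) → (∀ i → 0 < g i) → 0 < prodF g
prodF-pos {k = zero}  g pos = z<s
prodF-pos {k = suc k} g pos = *-mono-< {0} {g zero} {0} (pos zero) (prodF-pos (g ∘ suc) (pos ∘ suc))

∣-between-prime : ∀ {δ q} → 0 < B → Prime q → B ∣ δ → δ ∣ B * q → δ ≡ B ⊎ δ ≡ B * q
∣-between-prime {B} {q = q} B>0 q-prime (divides t refl) δ∣Bq
  with prime⇒irreducible q-prime (*-cancelˡ-∣ B {{>-nonZero B>0}} (subst (_∣ B * q) (*-comm t B) δ∣Bq))
... | inj₁ refl = inj₁ (*-identityˡ B)
... | inj₂ refl = inj₂ (*-comm q B)

∤prime⇒coprime : ∀ {q} → Prime q → ¬ q ∣ t → Coprime t q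
∤prime⇒coprime {t} {q} q-prime q∤t with prime⇒irreducible q-prime (gcd[m,n]∣n t q)
... | inj₁ gcd≡1 = gcd≡1⇒coprime gcd≡1
... | inj₂ gcd≡q = ⊥-elim (q∤t (subst (_∣ t) gcd≡q (gcd[m,n]∣m t q)))

coprime-∣-^* : ∀ {q R} → Coprime t q → ∀ a → t ∣ q ^ a * R → t ∣ R
coprime-∣-^* {R = R} coprime zero    t∣ = subst (_ ∣_) (*-identityˡ R) t∣
coprime-∣-^* {t} {q} {R} coprime (suc a) t∣ =
  coprime-∣-^* coprime a (coprime-divisor coprime (subst (t ∣_) (*-assoc q (q ^ a) R) t∣))

∣prodF-^⇒prime-factor : (q : Fin k → ℕ) → (∀ i → Prime (q i)) → (f : Fin k → ℕ) →
  t ∣ prodF (λ i → q i ^ f i) → t ≢ 1 → ∃[ i ] ∃[ u ] f i ≡ suc u × q i ∣ t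
∣prodF-^⇒prime-factor {k = zero}  q q-prime f t∣1 t≢1 = ⊥-elim (t≢1 (∣1⇒≡1 t∣1))
∣prodF-^⇒prime-factor {k = suc k} {t} q q-prime f t∣ t≢1 with q zero ∣? t | f zero in f₀≡
... | yes q₀∣t | suc u = zero , u , f₀≡ , q₀∣t
... | yes _    | zero  = Product.map suc id
  (∣prodF-^⇒prime-factor (q ∘ suc) (q-prime ∘ suc) (f ∘ suc) (subst (t ∣_) (*-identityˡ _) t∣) t≢1)
... | no q₀∤t  | f₀    = Product.map suc id
  (∣prodF-^⇒prime-factor (q ∘ suc) (q-prime ∘ suc) (f ∘ suc)
    (coprime-∣-^* (∤prime⇒coprime (q-prime zero) q₀∤t) f₀ t∣) t≢1)

min-∣-chain : ∀ {top} (Q : List ℕ) → 0 < top → (∀ {q} → q ∈ Q → q ∣ top) → IsChain Q →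
  ∀ {q} → q ∈ Q → min top Q ∣ q
min-∣-chain {top} Q top>0 Q∣top chain {q} q∈ = [ id , q∣min⇒min∣q ]′ comparable
  where
  comparable : Comparable (min top Q) q
  comparable = argmin-all id {P = λ x → Comparable x q} (inj₂ (Q∣top q∈)) (All.tabulate (λ x∈ → chain x∈ q∈))
  min≢0 : min top Q ≢ 0
  min≢0 eq = >⇒≢ top>0 (0∣⇒≡0 (subst (_∣ top) eq (argmin-all id {P = _∣ top} ∣-refl (All.tabulate Q∣top))))
  q∣min⇒min∣q : q ∣ min top Q → min top Q ∣ q
  q∣min⇒min∣q q∣min = subst (_∣ q)
    (≤-antisym (∣⇒≤ {{≢-nonZero min≢0}} q∣min) (All.lookup (min≤xs top Q) q∈)) ∣-refl

module DivisorChains {k : ℕ} (p : Fin k → ℕ) (p-prime : ∀ i → Prime (p i)) where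

  prodPow : (Fin k → ℕ) → ℕ
  prodPow f = prodF (λ i → p i ^ f i)

  1<p : ∀ i → 1 < p i
  1<p i = nonTrivial⇒n>1 (p i) {{prime⇒nonTrivial (p-prime i)}}

  <*p : 0 < B → ∀ i → B < B * p i
  <*p {B} B>0 i = m<m*n B (p i) {{>-nonZero B>0}} (1<p i)

  *p>0 : 0 < B → ∀ i → 0 < B * p i
  *p>0 B>0 i = <-trans B>0 (<*p B>0 i)

  prodPow>0 : ∀ f → 0 < prodPow f
  prodPow>0 f = prodF-pos _ (λ i → m^n>0 (p i) {{prime⇒nonZero (p-prime i)}} (f i))

  *-prodPow-updateAt-pred : ∀ B (f : Fin k → ℕ) i {u} → f i ≡ suc u →
    B * prodPow f ≡ B * p i * prodPow (updateAt f i pred)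
  *-prodPow-updateAt-pred B f i fᵢ≡ =
    trans (cong (B *_) (prodF-updateAt-pred (λ j x → p j ^ x) f i (p i) fᵢ≡ refl)) (sym (*-assoc B (p i) _))

  *-prodPow-sumF≡0 : ∀ B (f : Fin k → ℕ) → sumF f ≡ 0 → B * prodPow f ≡ B
  *-prodPow-sumF≡0 B f Σf≡0 =
    trans (cong (B *_) (sumF≡0⇒prodF≡1 (λ j x → p j ^ x) f (λ _ → refl) Σf≡0)) (*-identityʳ B)

  *-prodPow-sumF≡suc : ∀ B (f : Fin k → ℕ) → 0 < B → sumF f ≡ suc N → B * prodPow f ≢ B
  *-prodPow-sumF≡suc B f B>0 Σf≡ eq with sumF≡suc⇒positive f Σf≡
  ... | i , u , fᵢ≡ = <-irrefl (sym eq) (begin-strict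
    B                     <⟨ <*p B>0 i ⟩
    B * p i               ≤⟨ m≤m*n (B * p i) R {{>-nonZero (prodPow>0 (updateAt f i pred))}} ⟩
    B * p i * R           ≡⟨ *-prodPow-updateAt-pred B f i fᵢ≡ ⟨
    B * prodPow f         ∎)
    where
    open ≤-Reasoning
    R : ℕ
    R = prodPow (updateAt f i pred)

  chain : ℕ → List (Fin k) → List ℕ
  chain B []      = [ B ]
  chain B (i ∷ w) = B ∷ chain (B * p i) w

  ∈-chain⇒∣ : ∀ {d} w → d ∈ chain B w → B ∣ d
  ∈-chain⇒∣ []      (here refl) = ∣-refl
  ∈-chain⇒∣ (i ∷ w) (here refl) = ∣-refl
  ∈-chain⇒∣ (i ∷ w) (there d∈)  = ∣-trans (m∣m*n (p i)) (∈-chain⇒∣ w d∈)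

  chain-head : ∀ {d} w → d ≡ B → d ∈ chain B w
  chain-head []      = here
  chain-head (_ ∷ _) = here

  chain-isChain : ∀ w → IsChain (chain B w)
  chain-isChain []      (here refl) (here refl) = inj₁ ∣-refl
  chain-isChain (i ∷ w) (here refl) y∈          = inj₁ (∈-chain⇒∣ (i ∷ w) y∈)
  chain-isChain (i ∷ w) (there x∈)  (here refl) = inj₂ (∈-chain⇒∣ (i ∷ w) (there x∈))
  chain-isChain (i ∷ w) (there x∈)  (there y∈)  = chain-isChain w x∈ y∈

  ∈-chain⇒∣top : ∀ N f B {w d} → w ∈ words N f → d ∈ chain B w → d ∣ B * prodPow f
  ∈-chain⇒∣top zero    f B (here refl) (here refl) = m∣m*n _
  ∈-chain⇒∣top (suc N) f B {d = d} w∈ d∈ with ∈-words-suc⁻ {N = N} f w∈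
  ... | i , u , w′ , fᵢ≡ , refl , w′∈ with d∈
  ...   | here refl = m∣m*n _
  ...   | there d∈′ = subst (d ∣_) (sym (*-prodPow-updateAt-pred B f i fᵢ≡))
                        (∈-chain⇒∣top N (updateAt f i pred) (B * p i) w′∈ d∈′)

  chain-maximal : ∀ N f B {w δ} → 0 < B → sumF f ≡ N → w ∈ words N f → B ∣ δ → δ ∣ B * prodPow f →
    (∀ {c} → c ∈ chain B w → Comparable δ c) → δ ∈ chain B w
  chain-maximal zero    f B B>0 Σf≡0 (here refl) B∣δ δ∣top _ =
    here (∣-antisym (subst (_ ∣_) (*-prodPow-sumF≡0 B f Σf≡0) δ∣top) B∣δ)
  chain-maximal (suc N) f B {δ = δ} B>0 Σf≡ w∈ B∣δ δ∣top comparable with ∈-words-suc⁻ {N = N} f w∈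
  ... | i , u , w′ , fᵢ≡ , refl , w′∈ with comparable (there (chain-head w′ refl))
  ...   | inj₁ δ∣Bpᵢ = [ here , there ∘ chain-head w′ ]′ (∣-between-prime B>0 (p-prime i) B∣δ δ∣Bpᵢ)
  ...   | inj₂ Bpᵢ∣δ = there (chain-maximal N (updateAt f i pred) (B * p i)
                          (*p>0 B>0 i)
                          (sumF-updateAt-pred f i fᵢ≡ Σf≡) w′∈ Bpᵢ∣δ
                          (subst (δ ∣_) (*-prodPow-updateAt-pred B f i fᵢ≡) δ∣top)
                          (comparable ∘ there))

  chain-injective : Injective _≡_ _≡_ p → ∀ N f B {w w′} → 0 < B → w ∈ words N f → w′ ∈ words N f →
    chain B w ⊆ chain B w′ → w ≡ w′
  chain-injective p-inj zero    f B B>0 (here refl) (here refl) _ = refl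
  chain-injective p-inj (suc N) f B B>0 w∈ w′∈ w⊆w′
    with ∈-words-suc⁻ {N = N} f w∈ | ∈-words-suc⁻ {N = N} f w′∈
  ... | i , _ , v , fᵢ≡ , refl , v∈ | j , _ , v′ , _ , refl , v′∈ with w⊆w′ (there (chain-head v refl))
  ...   | here Bpᵢ≡B = ⊥-elim (<-irrefl (sym Bpᵢ≡B) (<*p B>0 i))
  ...   | there Bpᵢ∈ with prime⇒irreducible (p-prime i)
                            (*-cancelˡ-∣ B {{>-nonZero B>0}} (∈-chain⇒∣ v′ Bpᵢ∈))
  ...     | inj₁ pⱼ≡1 = ⊥-elim (<-irrefl (sym pⱼ≡1) (1<p j))
  ...     | inj₂ pⱼ≡pᵢ with p-inj pⱼ≡pᵢ
  ...       | refl = cong (i ∷_) (chain-injective p-inj N (updateAt f i pred) (B * p i)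
                                    (*p>0 B>0 i) v∈ v′∈ v⊆v′)
    where
    v⊆v′ : chain (B * p i) v ⊆ chain (B * p i) v′
    v⊆v′ d∈ with w⊆w′ (there d∈)
    ... | here refl = ⊥-elim (<⇒≱ (<*p B>0 i) (∣⇒≤ {{>-nonZero B>0}} (∈-chain⇒∣ v d∈)))
    ... | there d∈′ = d∈′

  -- The least element m of Q (or the top B * prodPow f, if Q is empty) divides all of Q;
  -- m = B * m/B with m/B ≢ 1, and a prime factor p i of m/B gives the first step.
  chain-first-step : ∀ N f B → 0 < B → sumF f ≡ suc N → (Q : List ℕ) →
    (∀ {q} → q ∈ Q → B ∣ q × q ∣ B * prodPow f × q ≢ B) → IsChain Q →
    ∃[ i ] ∃[ u ] f i ≡ suc u × (∀ {q} → q ∈ Q → B * p i ∣ q)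
  chain-first-step N f B B>0 Σf≡ Q Q-between Q-chain =
    let i , u , fᵢ≡ , pᵢ∣m/B = ∣prodF-^⇒prime-factor p p-prime f m/B∣prodPow m/B≢1
        Bpᵢ∣m : B * p i ∣ m
        Bpᵢ∣m = subst (B * p i ∣_) (sym m≡B*m/B) (*-monoʳ-∣ B pᵢ∣m/B)
    in i , u , fᵢ≡ , λ q∈ → ∣-trans Bpᵢ∣m (min-∣-chain Q top>0 (proj₁ ∘ proj₂ ∘ Q-between) Q-chain q∈)
    where
    top : ℕ
    top = B * prodPow f
    top>0 : 0 < top
    top>0 = *-mono-< {0} {B} {0} B>0 (prodPow>0 f)
    m : ℕ
    m = min top Q
    m-between : B ∣ m × m ∣ top × m ≢ B
    m-between = argmin-all id {P = λ x → B ∣ x × x ∣ top × x ≢ B}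
      (m∣m*n _ , ∣-refl , *-prodPow-sumF≡suc B f B>0 Σf≡) (All.tabulate Q-between)
    m/B : ℕ
    m/B = quotient (proj₁ m-between)
    m≡B*m/B : m ≡ B * m/B
    m≡B*m/B = m∣n⇒n≡m*quotient (proj₁ m-between)
    m/B∣prodPow : m/B ∣ prodPow f
    m/B∣prodPow = *-cancelˡ-∣ B {{>-nonZero B>0}} (subst (_∣ top) m≡B*m/B (proj₁ (proj₂ m-between)))
    m/B≢1 : m/B ≢ 1
    m/B≢1 m/B≡1 = proj₂ (proj₂ m-between) (trans m≡B*m/B (trans (cong (B *_) m/B≡1) (*-identityʳ B)))

  chain-extend : ∀ N f B → 0 < B → sumF f ≡ N → (Q : List ℕ) →
    (∀ {q} → q ∈ Q → B ∣ q × q ∣ B * prodPow f) → IsChain Q →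
    ∃[ w ] w ∈ words N f × Q ⊆ chain B w
  chain-extend zero    f B B>0 Σf≡0 Q Q-between _ = [] , here refl , λ q∈ →
    let B∣q , q∣top = Q-between q∈ in here (∣-antisym (subst (_ ∣_) (*-prodPow-sumF≡0 B f Σf≡0) q∣top) B∣q)
  chain-extend (suc N) f B B>0 Σf≡ Q Q-between Q-chain =
    let i , u , fᵢ≡ , Bpᵢ∣Q′ = chain-first-step N f B B>0 Σf≡ Q′ Q′-between Q′-chain
        w , w∈ , Q′⊆ = chain-extend N (updateAt f i pred) (B * p i) (*p>0 B>0 i)
          (sumF-updateAt-pred f i fᵢ≡ Σf≡) Q′
          (λ {q} q∈ → Bpᵢ∣Q′ q∈ ,
            subst (q ∣_) (*-prodPow-updateAt-pred B f i fᵢ≡) (proj₁ (proj₂ (Q′-between q∈))))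
          Q′-chain
    in i ∷ w , ∈-words-suc⁺ {N = N} f i fᵢ≡ w∈ , λ {q} q∈ → case-B q q∈ Q′⊆
    where
    Q′ : List ℕ
    Q′ = filter (λ q → ¬? (q ≟ B)) Q
    Q′-between : ∀ {q} → q ∈ Q′ → B ∣ q × q ∣ B * prodPow f × q ≢ B
    Q′-between q∈ = let q∈Q , q≢B = ∈-filter⁻ (λ q → ¬? (q ≟ B)) {xs = Q} q∈ in
      proj₁ (Q-between q∈Q) , proj₂ (Q-between q∈Q) , q≢B
    Q′-chain : IsChain Q′
    Q′-chain x∈ y∈ = Q-chain (proj₁ (∈-filter⁻ (λ q → ¬? (q ≟ B)) {xs = Q} x∈))
                             (proj₁ (∈-filter⁻ (λ q → ¬? (q ≟ B)) {xs = Q} y∈))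
    case-B : ∀ {C : List ℕ} q → q ∈ Q → (q ∈ Q′ → q ∈ C) → q ∈ B ∷ C
    case-B q q∈ later with q ≟ B
    ... | yes q≡B = here q≡B
    ... | no  q≢B = there (later (∈-filter⁺ (λ q → ¬? (q ≟ B)) q∈ q≢B))

fromDecidable : ∀ {n} {P : Pred (Fin n) 0ℓ} → Decidable P → Subset n
fromDecidable P? = tabulate (does ∘ P?)

∈-fromDecidable : ∀ {n} {P : Pred (Fin n) 0ℓ} (P? : Decidable P) {x} → x ∈ₛ fromDecidable P? ⇔ P x
∈-fromDecidable P? {x} = mk⇔
  (λ x∈ → invert (subst (Reflects _) (trans (sym (lookup∘tabulate (does ∘ P?) x)) ([]=⇒lookup x∈))
                        (proof (P? x))))
  (λ Px → lookup⇒[]= x _ (trans (lookup∘tabulate (does ∘ P?) x) (dec-true (P? x) Px)))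

map⁺-injectiveOn : ∀ {A B : Set} (f : A → B) {xs : List A} →
  (∀ {x y} → x ∈ xs → y ∈ xs → f x ≡ f y → x ≡ y) → Unique xs → Unique (map f xs)
map⁺-injectiveOn f {[]}     _   []             = []
map⁺-injectiveOn f {x ∷ xs} inj (x∉xs ∷ unique) =
  All.map⁺ (All.tabulate λ y∈ fx≡fy → All.lookup x∉xs y∈ (inj (here refl) (there y∈) fx≡fy))
  ∷ map⁺-injectiveOn f (λ x∈ y∈ → inj (there x∈) (there y∈)) unique

module MaximalCliques {k : ℕ} (p : Fin k → ℕ) (p-prime : ∀ i → Prime (p i))
                      (p-injective : Injective _≡_ _≡_ p) (e : Fin k → ℕ) (m : ℕ) (n≡ : suc m ≡ prodF (λ i → p i ^ e i)) where
  open ℤ/suc m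
  open DivisorChains p p-prime

  1*prodPow≡n : 1 * prodPow e ≡ n
  1*prodPow≡n = trans (*-identityˡ _) (sym n≡)

  W : List (List (Fin k))
  W = words (sumF e) e

  cliqueOf : List (Fin k) → Subset n
  cliqueOf w = fromDecidable (λ a → gcdₙ a ∈? chain 1 w)

  ∈-cliqueOf : ∀ {a w} → a ∈ₛ cliqueOf w ⇔ gcdₙ a ∈ chain 1 w
  ∈-cliqueOf {w = w} = ∈-fromDecidable (λ a → gcdₙ a ∈? chain 1 w)

  ∈-chain⇒∣n : ∀ {w d} → w ∈ W → d ∈ chain 1 w → d ∣ n
  ∈-chain⇒∣n {d = d} w∈ d∈ = subst (d ∣_) 1*prodPow≡n (∈-chain⇒∣top (sumF e) e 1 w∈ d∈)

  ∈-chain⇒mod∈cliqueOf : ∀ {w d} → w ∈ W → d ∈ chain 1 w → d mod n ∈ₛ cliqueOf w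
  ∈-chain⇒mod∈cliqueOf {w} w∈ d∈ =
    from ∈-cliqueOf (subst (_∈ chain 1 w) (sym (gcdₙ-mod (∈-chain⇒∣n w∈ d∈))) d∈)

  clique⇒comparable : ∀ {T x y} → IsClique T → x ∈ₛ T → y ∈ₛ T → Comparable (gcdₙ x) (gcdₙ y)
  clique⇒comparable {x = x} {y} T-clique x∈ y∈ with x Fin.≟ y
  ... | yes refl = inj₁ ∣-refl
  ... | no  x≢y  = proj₂ (to endoAdj⇔ (T-clique x y x∈ y∈ x≢y))

  cliqueOf-isClique : ∀ w → IsClique (cliqueOf w)
  cliqueOf-isClique w a b a∈ b∈ a≢b =
    from endoAdj⇔ (a≢b , chain-isChain w (to ∈-cliqueOf a∈) (to ∈-cliqueOf b∈))

  cliqueOf-maximal : ∀ {w} → w ∈ W → IsMaximalClique (cliqueOf w)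
  cliqueOf-maximal {w} w∈ = cliqueOf-isClique w , λ T T-clique w⊆T {x} x∈T →
    from ∈-cliqueOf (chain-maximal (sumF e) e 1 z<s refl w∈ (1∣ _)
      (subst (gcdₙ x ∣_) (sym 1*prodPow≡n) (gcd[m,n]∣n (toℕ x) n))
      λ {c} c∈ → subst (Comparable (gcdₙ x)) (gcdₙ-mod (∈-chain⇒∣n w∈ c∈))
                   (clique⇒comparable T-clique x∈T (w⊆T (∈-chain⇒mod∈cliqueOf w∈ c∈))))

  maximal⇒cliqueOf : ∀ {S} → IsMaximalClique S → ∃[ w ] w ∈ W × S ≡ cliqueOf w
  maximal⇒cliqueOf {S} (S-clique , S-maximal) =
    let w , w∈ , Q⊆ = chain-extend (sumF e) e 1 z<s refl Q Q-between Q-chain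
        S⊆ : S ⊆ₛ cliqueOf w
        S⊆ {a} a∈ = from ∈-cliqueOf (Q⊆ (∈-map⁺ gcdₙ (∈-filter⁺ (_∈ₛ? S) (∈-allFin a) a∈)))
    in w , w∈ , ⊆-antisym S⊆ (S-maximal (cliqueOf w) (cliqueOf-isClique w) S⊆)
    where
    Q : List ℕ
    Q = map gcdₙ (filter (_∈ₛ? S) (allFin n))
    ∈Q⇒ : ∀ {q} → q ∈ Q → ∃[ a ] a ∈ₛ S × q ≡ gcdₙ a
    ∈Q⇒ q∈ = let a , a∈ , q≡ = ∈-map⁻ gcdₙ q∈ in a , proj₂ (∈-filter⁻ (_∈ₛ? S) {xs = allFin n} a∈) , q≡
    Q-between : ∀ {q} → q ∈ Q → 1 ∣ q × q ∣ 1 * prodPow e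
    Q-between {q} q∈ = let a , _ , q≡ = ∈Q⇒ q∈ in
      1∣ q , subst₂ _∣_ (sym q≡) (sym 1*prodPow≡n) (gcd[m,n]∣n (toℕ a) n)
    Q-chain : IsChain Q
    Q-chain x∈ y∈ with ∈Q⇒ x∈ | ∈Q⇒ y∈
    ... | a , a∈ , refl | b , b∈ , refl = clique⇒comparable S-clique a∈ b∈

  cliqueOf-injective : ∀ {w w′} → w ∈ W → w′ ∈ W → cliqueOf w ≡ cliqueOf w′ → w ≡ w′
  cliqueOf-injective {w} {w′} w∈ w′∈ eq = chain-injective p-injective (sumF e) e 1 z<s w∈ w′∈ λ {d} d∈ →
    subst (_∈ chain 1 w′) (gcdₙ-mod (∈-chain⇒∣n w∈ d∈))
      (to ∈-cliqueOf (subst (d mod n ∈ₛ_) eq (∈-chain⇒mod∈cliqueOf w∈ d∈)))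

  ∈-map-cliqueOf⇔maximal : ∀ S → S ∈ map cliqueOf W ⇔ IsMaximalClique S
  ∈-map-cliqueOf⇔maximal S = mk⇔
    (λ S∈ → let w , w∈ , S≡ = ∈-map⁻ cliqueOf S∈ in subst IsMaximalClique (sym S≡) (cliqueOf-maximal w∈))
    (λ S-maximal → let w , w∈ , S≡ = maximal⇒cliqueOf S-maximal in
      subst (_∈ map cliqueOf W) (sym S≡) (∈-map⁺ cliqueOf w∈))

  numMaximalCliques : NumMaximalCliques n (multinomial e)
  numMaximalCliques =
    map cliqueOf W ,
    map⁺-injectiveOn cliqueOf cliqueOf-injective (words-unique (sumF e) e) ,
    ∈-map-cliqueOf⇔maximal ,
    trans (length-map cliqueOf W) (sym (multinomial≡length-words e))

theorem2p7 : (n k : ℕ) (p : Fin k → ℕ) (e : Fin k → ℕ) →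
    (∀ i → Prime (p i)) → Injective _≡_ _≡_ p →
    n ≡ prodF (λ i → p i ^ e i) →
    NumMaximalCliques n (multinomial e)
theorem2p7 zero    k p e p-prime _ 0≡ = ⊥-elim (<-irrefl 0≡ (DivisorChains.prodPow>0 p p-prime e))
theorem2p7 (suc m) k p e p-prime p-injective n≡ =
  MaximalCliques.numMaximalCliques p p-prime p-injective e m n≡
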